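{- Let $\mathfrak{A}$ be a Heyting algebra, $a\in|\mathfrak{A}|$, and $F_a=\{x\vee(x\rightarrow a): x\in|\mathfrak{A}|\}$. For any $y\in|\mathfrak{A}|$ the following are equivalent: (a) $y\in F_a$; (b) $y\rightarrow a\le a$ and $a\le y$; (c) $y\rightarrow a\le y$. -}

module Defs where

open import Level using (_⊔_)
open import Data.Product using (∃)
open import Relation.Binary.Lattice.Bundles using (HeytingAlgebra)

InF : ∀ {c ℓ₁ ℓ₂} (𝔄 : HeytingAlgebra c ℓ₁ ℓ₂) →
      HeytingAlgebra.Carrier 𝔄 → HeytingAlgebra.Carrier 𝔄 → Set (c ⊔ ℓ₁)
InF 𝔄 a y = ∃ λ x → y ≈ (x ∨ (x ⇨ a))
  where open HeytingAlgebra 𝔄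

-- If y = x ∨ (x ⇨ a) then x ≤ y, so y ⇨ a ≤ x ⇨ a ≤ y by antitonicity of _⇨ a; conversely
-- y ⇨ a ≤ y makes y ∨ (y ⇨ a) collapse to y.  Condition (b) is equivalent to (c) because
-- a ≤ y ⇨ a always holds, while y ⇨ a ≤ y forces y ⇨ a ≤ (y ⇨ a) ∧ y ≤ a.
module Submission where

open import Defs
open import Data.Product using (_×_; _,_)
open import Function.Bundles using (_⇔_; mk⇔)
import Function.Properties.Equivalence as ⇔
open import Relation.Binary.Lattice.Bundles using (HeytingAlgebra)
import Relation.Binary.Lattice.Properties.HeytingAlgebra as HeytingAlgebraProperties
import Relation.Binary.Reasoning.PartialOrder as PosetReasoning

module _ {c ℓ₁ ℓ₂} (𝔄 : HeytingAlgebra c ℓ₁ ℓ₂) where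

  open HeytingAlgebra 𝔄
  open HeytingAlgebraProperties 𝔄 using (y≤x⇨y; ⇨ˡ-contravariant; ⇨-applyˡ)
  open PosetReasoning poset

  x⇨y≤x⇒x⇨y≤y : ∀ {x y} → x ⇨ y ≤ x → x ⇨ y ≤ y
  x⇨y≤x⇒x⇨y≤y p = trans (∧-greatest refl refl) (⇨-applyˡ p)

  InF⇒⇨≤ : ∀ {a y} → InF 𝔄 a y → y ⇨ a ≤ y
  InF⇒⇨≤ {a} {y} (x , y≈x∨x⇨a) = begin
    y ⇨ a         ≤⟨ ⇨ˡ-contravariant x≤y ⟩
    x ⇨ a         ≤⟨ y≤x∨y x (x ⇨ a) ⟩
    x ∨ (x ⇨ a)   ≈⟨ Eq.sym y≈x∨x⇨a ⟩
    y             ∎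
    where
    x≤y : x ≤ y
    x≤y = trans (x≤x∨y x (x ⇨ a)) (reflexive (Eq.sym y≈x∨x⇨a))

  ⇨≤⇒InF : ∀ {a y} → y ⇨ a ≤ y → InF 𝔄 a y
  ⇨≤⇒InF {a} {y} p = y , antisym (x≤x∨y y (y ⇨ a)) (∨-least refl p)

  InF⇔⇨≤ : ∀ {a y} → InF 𝔄 a y ⇔ y ⇨ a ≤ y
  InF⇔⇨≤ = mk⇔ InF⇒⇨≤ ⇨≤⇒InF

  ⇨≤∧≤⇔⇨≤ : ∀ {a y} → (y ⇨ a ≤ a × a ≤ y) ⇔ y ⇨ a ≤ y
  ⇨≤∧≤⇔⇨≤ = mk⇔ (λ (y⇨a≤a , a≤y) → trans y⇨a≤a a≤y)
                (λ y⇨a≤y → x⇨y≤x⇒x⇨y≤y y⇨a≤y , trans y≤x⇨y y⇨a≤y)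

propositionP : ∀ {c ℓ₁ ℓ₂} (𝔄 : HeytingAlgebra c ℓ₁ ℓ₂) (a y : HeytingAlgebra.Carrier 𝔄) →
    let open HeytingAlgebra 𝔄 in
      (InF 𝔄 a y ⇔ ((y ⇨ a) ≤ a × a ≤ y))
      × (((y ⇨ a) ≤ a × a ≤ y) ⇔ (y ⇨ a) ≤ y)
propositionP 𝔄 a y =
  ⇔.trans (InF⇔⇨≤ 𝔄) (⇔.sym (⇨≤∧≤⇔⇨≤ 𝔄)) , ⇨≤∧≤⇔⇨≤ 𝔄
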